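{- In a next generation Fibonacci heap (FH:TNG) storing $n$ elements, the amortized cost of the Delete-Min operation, with respect to the potential $\Phi$ defined in the context, is $O(\lg n)$.
   Context: $\lg$ is the binary logarithm; Fibonacci numbers are $F_1=F_2=1$, $F_i=F_{i-1}+F_{i-2}$. Keys are from a totally ordered universe with ties broken consistently. An FH:TNG stores its $n$ elements in a sequence of set slots $S_3,S_4,\ldots,S_k$, each a doubly-linked list with its size stored, with pivots such that every element of $S_i$ is smaller than every element of $S_j$ for $i<j$. Invariants: each set is empty or nonempty; a nonempty $S_i$ has size between $F_i$ and $F_{i+3}$, except that the first set $S_3$ has no minimum size; at most eight consecutive empty sets and at most two consecutive nonempty sets. $S_i$ is full if $|S_i|=F_{i+3}$ and underfull if $|S_i|=F_i$. Invariant-restoring operations: overflow-down (full $S_i$, $S_{i+1}$ empty: move $S_i$ into slot $i+1$); overflow-thru (full $S_i$, $S_{i+1}$ nonempty, hence $S_{i+2}$ empty: concatenate $S_i$ into $S_{i+1}$ and move the $F_{i+3}$ largest elements into $S_{i+2}$ by linear-time selection); underflow-up (underfull $S_i$, $S_{i-1}$ empty: move $S_i$ into slot $i-1$); underflow-thru (underfull $S_i$, $S_{i-1}$ nonempty: concatenate $S_i$ and $S_{i-1}$ and move the $F_i$ smallest elements into the empty slot $S_{i-2}$ by linear-time selection); merge-down (three consecutive nonempty $S_{i-2},S_{i-1},S_i$ with $S_{i+1}$ empty: concatenate $S_{i-1}$ and $S_i$ into slot $i+1$ in constant time); split-up (nine consecutive empty sets $S_{i-9},\ldots,S_{i-1}$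 with $S_i$ nonempty: split $S_i$ by linear-time selection into slots $S_{i-2}$ (smaller elements) and $S_{i-1}$, proportionally in Fibonacci sizes). Delete-Min: find and remove the smallest element of the first nonempty set $S_j$ and decrement its size; if $S_j$ becomes underfull, perform one underflow-up or underflow-thru, then merge-downs (and split-ups) as needed until all invariants hold. Potential: $\uparrow_i=\sum_{j<i}|S_j|$; $\phi^{\mathrm{nonempty}}_i=1$ if $S_i$ nonempty, else $0$; $\phi^{\mathrm{size}}_i=0$ if $S_i$ empty or $F_{i+1}\le|S_i|\le F_{i+2}$, $=F_{i+1}-|S_i|$ if $F_i\le|S_i|<F_{i+1}$, $=|S_i|-F_{i+2}$ if $F_{i+2}<|S_i|\le F_{i+3}$; $\phi^{\uparrow}_i=0$ if $i\le2$ or $S_i$ empty, else $\max\{0,F_{i-3}-\uparrow_i\}$; $\Phi=\sum_i(\phi^{\uparrow}_i+\phi^{\mathrm{size}}_i+\phi^{\mathrm{nonempty}}_i)$. Amortized cost is actual cost plus change in $\Phi$. -}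

module Defs where

open import Level using (0ℓ)
open import Data.Nat using (ℕ; zero; suc; _+_; _*_; _∸_; _≤_; _<_)
open import Data.List using (List; []; _∷_; length; _++_; map)
open import Data.Nat.ListAction using (sum)
open import Data.List.Relation.Unary.All using (All)
open import Data.List.Relation.Binary.Permutation.Propositional using (_↭_)
open import Data.Product using (_×_; Σ; _,_)
open import Data.Sum using (_⊎_)
open import Relation.Binary.Bundles using (StrictTotalOrder)
open import Relation.Binary.PropositionalEquality using (_≡_; _≢_)
open import Relation.Nullary using (¬_)

fib : ℕ → ℕ
fib zero = zero
fib (suc zero) = 1
fib (suc (suc n)) = fib (suc n) + fib n

-- nz s x = 0 if s = 0, and x otherwise ("only counts for nonempty sets").
nz : ℕ → ℕ → ℕ
nz zero    _ = 0
nz (suc _) x = x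

-- The FH:TNG over a totally ordered key universe (strict total order,
-- i.e. ties already broken consistently).
module FH (O : StrictTotalOrder 0ℓ 0ℓ 0ℓ) where

  open StrictTotalOrder O renaming (Carrier to Key; _<_ to _≺_) using ()

  -- A heap is the list of its set slots; the list entry at position i is S_i.
  -- Positions beyond the end of the list are empty slots. Slots 0,1,2 do not
  -- exist (the first set is S₃); the invariant forces them to be empty.
  Heap : Set
  Heap = List (List Key)

  slot : Heap → ℕ → List Key
  slot []      _       = []
  slot (s ∷ h) zero    = s
  slot (s ∷ h) (suc i) = slot h i

  size : Heap → ℕ → ℕ
  size H i = length (slot H i)

  Empty : Heap → ℕ → Set
  Empty H i = slot H i ≡ []

  NonEmpty : Heap → ℕ → Set
  NonEmpty H i = 0 < size H i

  elems : Heap → ℕ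
  elems H = sum (map length H)

  _≺≺_ : List Key → List Key → Set
  xs ≺≺ ys = All (λ x → All (λ y → x ≺ y) ys) xs

  record Inv (H : Heap) : Set where
    field
      noLowSlots : ∀ i → i < 3 → Empty H i
      pivots     : ∀ i j → i < j → slot H i ≺≺ slot H j
      sizeMax    : ∀ i → NonEmpty H i → size H i ≤ fib (i + 3)
      sizeMin    : ∀ i → 3 < i → NonEmpty H i → fib i ≤ size H i
      -- at most eight consecutive empty sets: no nine consecutive empty
      -- slots S_i,…,S_{i+8} (i ≥ 3) followed by a nonempty S_{i+9}
      emptyRuns  : ∀ i → 3 ≤ i → (∀ k → k < 9 → Empty H (i + k)) → Empty H (i + 9)
      nonemptyRuns : ∀ i → ¬ (NonEmpty H i × NonEmpty H (1 + i) × NonEmpty H (2 + i))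

  up : Heap → ℕ → ℕ
  up H zero    = 0
  up H (suc i) = up H i + size H i

  φup : Heap → ℕ → ℕ
  φup H zero = 0
  φup H (suc zero) = 0
  φup H (suc (suc zero)) = 0
  φup H (suc (suc (suc j))) = nz (size H (3 + j)) (fib j ∸ up H (3 + j))

  φsize : Heap → ℕ → ℕ
  φsize H i = nz (size H i) ((fib (1 + i) ∸ size H i) + (size H i ∸ fib (2 + i)))

  φnonempty : Heap → ℕ → ℕ
  φnonempty H i = nz (size H i) 1

  φ : Heap → ℕ → ℕ
  φ H i = φup H i + φsize H i + φnonempty H i

  ΦUpTo : Heap → ℕ → ℕ
  ΦUpTo H zero    = 0
  ΦUpTo H (suc k) = ΦUpTo H k + φ H k

  -- all slots beyond the list are empty and contribute 0
  Φ : Heap → ℕ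
  Φ H = ΦUpTo H (length H)

  -- Elementary operations, as relations  Op H H' cost.
  -- Actual cost is counted in elementary steps: constant-time operations
  -- cost 1, a linear-time scan/selection over m elements costs m.

  Same1 : Heap → Heap → ℕ → Set
  Same1 H H' a = ∀ k → k ≢ a → slot H' k ≡ slot H k

  Same2 : Heap → Heap → ℕ → ℕ → Set
  Same2 H H' a b = ∀ k → k ≢ a → k ≢ b → slot H' k ≡ slot H k

  Same3 : Heap → Heap → ℕ → ℕ → ℕ → Set
  Same3 H H' a b c = ∀ k → k ≢ a → k ≢ b → k ≢ c → slot H' k ≡ slot H k

  record RemoveMin (j : ℕ) (H H' : Heap) (cost : ℕ) : Set where
    field
      firstNonEmpty : NonEmpty H j × (∀ k → k < j → Empty H k)
      m    : Key
      rest : List Key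
      perm : slot H j ↭ m ∷ rest
      isMin : All (λ x → ¬ (x ≺ m)) rest
      new  : slot H' j ≡ rest
      same : Same1 H H' j
      cst  : cost ≡ size H j

  record UnderflowUp (i : ℕ) (H H' : Heap) (cost : ℕ) : Set where
    field
      idx   : 4 ≤ i
      under : size H i ≡ fib i
      prevE : Empty H (i ∸ 1)
      newP  : slot H' (i ∸ 1) ≡ slot H i
      newI  : Empty H' i
      same  : Same2 H H' (i ∸ 1) i
      cst   : cost ≡ 1

  record UnderflowThru (i : ℕ) (H H' : Heap) (cost : ℕ) : Set where
    field
      idx    : 5 ≤ i
      under  : size H i ≡ fib i
      prevNE : NonEmpty H (i ∸ 1)
      prev2E : Empty H (i ∸ 2)
      perm   : slot H' (i ∸ 2) ++ slot H' (i ∸ 1) ↭ slot H (i ∸ 1) ++ slot H i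
      small  : size H' (i ∸ 2) ≡ fib i
      order  : slot H' (i ∸ 2) ≺≺ slot H' (i ∸ 1)
      newI   : Empty H' i
      same   : Same3 H H' (i ∸ 2) (i ∸ 1) i
      cst    : cost ≡ size H (i ∸ 1) + size H i

  record MergeDown (i : ℕ) (H H' : Heap) (cost : ℕ) : Set where
    field
      idx  : 5 ≤ i
      ne   : NonEmpty H (i ∸ 2) × NonEmpty H (i ∸ 1) × NonEmpty H i
      nxtE : Empty H (1 + i)
      new  : slot H' (1 + i) ≡ slot H (i ∸ 1) ++ slot H i
      newE : Empty H' (i ∸ 1) × Empty H' i
      same : Same3 H H' (i ∸ 1) i (1 + i)
      cst  : cost ≡ 1

  -- S_{i-9},…,S_{i-1} empty, S_i nonempty: split S_i by linear-time selection
  -- into S_{i-2} (smaller elements) and S_{i-1}, proportionally in Fibonacci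
  -- sizes: |S'_{i-2}| is |S_i|·F_{i-2}/F_i rounded down or up.
  record SplitUp (i : ℕ) (H H' : Heap) (cost : ℕ) : Set where
    field
      idx   : 12 ≤ i
      empt  : ∀ k → 1 ≤ k → k ≤ 9 → Empty H (i ∸ k)
      ne    : NonEmpty H i
      perm  : slot H' (i ∸ 2) ++ slot H' (i ∸ 1) ↭ slot H i
      order : slot H' (i ∸ 2) ≺≺ slot H' (i ∸ 1)
      propL : fib i * size H' (i ∸ 2) < fib (i ∸ 2) * size H i + fib i
      propR : fib (i ∸ 2) * size H i < fib i * size H' (i ∸ 2) + fib i
      newI  : Empty H' i
      same  : Same3 H H' (i ∸ 2) (i ∸ 1) i
      cst   : cost ≡ size H i

  data RestoreStep (H H' : Heap) (cost : ℕ) : Set where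
    merge : ∀ i → MergeDown i H H' cost → RestoreStep H H' cost
    split : ∀ i → SplitUp i H H' cost → RestoreStep H H' cost

  data Restore : Heap → Heap → ℕ → Set where
    done : ∀ {H} → Restore H H 0
    step : ∀ {H H₁ H₂ a b} → RestoreStep H H₁ a → Restore H₁ H₂ b → Restore H H₂ (a + b)

  -- S_j is underfull after the removal (S₃ has no minimum size)
  Underfull : ℕ → Heap → Set
  Underfull j H = 3 < j × size H j ≡ fib j

  record DeleteMinRun (H H' : Heap) (t : ℕ) : Set where
    field
      j  : ℕ
      H₁ : Heap
      t₁ : ℕ
      removal : RemoveMin j H H₁ t₁
      H₂ : Heap
      t₂ : ℕ
      underflow : (Underfull j H₁ × (UnderflowUp j H₁ H₂ t₂ ⊎ UnderflowThru j H₁ H₂ t₂))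
                ⊎ (¬ Underfull j H₁ × H₂ ≡ H₁ × t₂ ≡ 0)
      t₃ : ℕ
      restore : Restore H₂ H' t₃
      final : Inv H'
      total : t ≡ t₁ + t₂ + t₃

-- The first nonempty set S_j has j ≤ 11, since nine empty slots may not precede a
-- nonempty one, so removing its minimum costs at most F₁₄.  Lowering |S_j| by one
-- lowers ↑ᵢ by one for every i > j, which raises φᵢ of each nonempty slot by at most
-- one: Φ grows by at most the number of nonempty sets, 2 lg n + O(1).  As S_{j-1} is
-- empty, an underflow can only be an underflow-up of a slot below 12, which raises Φ
-- by a constant.  From then on all sizes respect the invariant up to a slack of one
-- below and two above and no three consecutive sets are nonempty, so no merge-down
-- applies, while a split-up of S_i pays for its cost |S_i| ≤ F_{i+3} + 2 out of the
-- potential: the term F_{i-3} − ↑ᵢ of φ↑ᵢ becomes F_{i-5} − ↑ᵢ in S_{i-2}, a drop of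
-- F_{i-5} because the nine empty slots below S_i keep ↑ᵢ below F_{i-4}, and by
-- Cassini's identity splitting in proportion F_{i-2} : F_{i-1} changes the φˢⁱᶻᵉ
-- terms by at most a constant.

module Submission where

open import Defs
open import Level using (0ℓ)
open import Data.Nat using (ℕ; _+_; _*_; _≤_; _<_)
open import Data.Nat.Logarithm using (⌊log₂_⌋)
open import Data.Product using (Σ)
open import Relation.Binary.Bundles using (StrictTotalOrder)

open import Data.Nat
  using (zero; suc; _∸_; _^_; ⌊_/2⌋; z≤n; s≤s; s≤s⁻¹; _≟_; _≤?_; _<?_; >-nonZero)
open import Data.Nat.Properties
open import Data.Nat.Logarithm using (⌊log₂⌋-mono-≤; ⌊log₂[2^n]⌋≡n)
open import Data.Nat.Tactic.RingSolver using (solve-∀; solve)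
open import Data.List using ([]; _∷_; length)
open import Data.List.Properties using (length-++)
open import Data.List.Relation.Binary.Permutation.Propositional.Properties using (↭-length)
open import Data.Product using (_×_; _,_; proj₁; proj₂)
open import Data.Sum using (_⊎_; inj₁; inj₂)
open import Data.Empty using (⊥; ⊥-elim)
open import Relation.Nullary using (yes; no)
open import Relation.Binary.Definitions using (tri<; tri≈; tri>)
open import Relation.Binary.PropositionalEquality
  using (_≡_; _≢_; refl; sym; trans; cong; cong₂; subst; subst₂; module ≡-Reasoning)
open import Algebra.Properties.CommutativeSemigroup +-commutativeSemigroup
  using (xy∙z≈xz∙y; xy∙z≈x∙zy; x∙yz≈xz∙y; x∙yz≈y∙xz; interchange)


∸-transfer : ∀ {X Y Z W α β} → X ≤ Z + α → W ≤ Y + β → X ∸ Y ≤ (Z ∸ W) + (α + β)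
∸-transfer {X} {Y} {Z} {W} {α} {β} X≤Z+α W≤Y+β = m≤n+o⇒m∸n≤o X Y (begin
  X                         ≤⟨ X≤Z+α ⟩
  Z + α                     ≤⟨ +-monoˡ-≤ α (m≤n+m∸n Z W) ⟩
  W + (Z ∸ W) + α           ≤⟨ +-monoˡ-≤ α (+-monoˡ-≤ (Z ∸ W) W≤Y+β) ⟩
  Y + β + (Z ∸ W) + α       ≡⟨ rearrange Y β (Z ∸ W) α ⟩
  Y + ((Z ∸ W) + (α + β))   ∎)
  where
  open ≤-Reasoning
  rearrange : ∀ y b d a → y + b + d + a ≡ y + (d + (a + b))
  rearrange = solve-∀

*-∸-transfer : ∀ r c x x′ y y′ {α β} → r * x ≤ c * y + α → c * y′ ≤ r * x′ + β →
               r * (x ∸ x′) ≤ c * (y ∸ y′) + (α + β)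
*-∸-transfer r c x x′ y y′ hx hy
  rewrite *-distribˡ-∸ r x x′ | *-distribˡ-∸ c y y′ = ∸-transfer hx hy

m∸n≤m∸[1+n]+1 : ∀ a b → a ∸ b ≤ (a ∸ suc b) + 1
m∸n≤m∸[1+n]+1 a b = ∸-transfer {Y = b} {Z = a} (m≤m+n a 0) (≤-reflexive (+-comm 1 b))

m∸n+n≤o : ∀ {m n o} → m ≤ o → n ≤ o → (m ∸ n) + n ≤ o
m∸n+n≤o {m} {n} m≤o n≤o with ≤-total n m
... | inj₁ n≤m = ≤-trans (≤-reflexive (m∸n+n≡m n≤m)) m≤o
... | inj₂ m≤n = ≤-trans (≤-reflexive (cong (_+ n) (m≤n⇒m∸n≡0 m≤n))) n≤o

m∸o+m≤n+m∸o : ∀ {a b u} → a ≤ b → u ≤ b → (a ∸ u) + a ≤ (b + a) ∸ u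
m∸o+m≤n+m∸o {a} {b} {u} a≤b u≤b = m+n≤o⇒m≤o∸n ((a ∸ u) + a) (begin
  (a ∸ u) + a + u   ≡⟨ xy∙z≈xz∙y (a ∸ u) a u ⟩
  (a ∸ u) + u + a   ≤⟨ +-monoˡ-≤ a (m∸n+n≤o a≤b u≤b) ⟩
  b + a             ∎)
  where open ≤-Reasoning

+-exchange : ∀ {a b c d} → a + b ≡ c + d → b + 1 ≡ d → a ≡ c + 1
+-exchange {a} {b} {c} eq b+1≡d =
  +-cancelʳ-≡ b a (c + 1) (trans eq (trans (cong (c +_) (sym b+1≡d)) (x∙yz≈xz∙y c b 1)))

≤-from-gap : ∀ {X Y c u v} → u ≤ v + 1 → X + c * v ≡ Y + c * u → X ≤ Y + c
≤-from-gap {X} {Y} {c} {u} {v} u≤v+1 eq = +-cancelʳ-≤ (c * v) X (Y + c) (begin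
  X + c * v          ≡⟨ eq ⟩
  Y + c * u          ≤⟨ +-monoʳ-≤ Y (*-monoʳ-≤ c u≤v+1) ⟩
  Y + c * (v + 1)    ≡⟨ solve (Y ∷ c ∷ v ∷ []) ⟩
  Y + c + c * v      ∎)
  where open ≤-Reasoning

amortize : ∀ {cost c P P′ gain loss} → P′ + gain ≤ P + loss → cost + c * loss ≤ c * gain →
           cost + c * P′ ≤ c * P
amortize {cost} {c} {P} {P′} {gain} {loss} drop paid = +-cancelʳ-≤ (c * loss) _ _ (begin
  cost + c * P′ + c * loss    ≡⟨ xy∙z≈xz∙y cost (c * P′) (c * loss) ⟩
  cost + c * loss + c * P′    ≤⟨ +-monoˡ-≤ (c * P′) paid ⟩
  c * gain + c * P′           ≡⟨ solve (c ∷ gain ∷ P′ ∷ []) ⟩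
  c * (P′ + gain)             ≤⟨ *-monoʳ-≤ c drop ⟩
  c * (P + loss)              ≡⟨ *-distribˡ-+ c P loss ⟩
  c * P + c * loss            ∎)
  where open ≤-Reasoning

distToRange : ℕ → ℕ → ℕ → ℕ
distToRange lo hi x = (lo ∸ x) + (x ∸ hi)

distToRange-inside : ∀ {lo hi x} → lo ≤ x → x ≤ hi → distToRange lo hi x ≡ 0
distToRange-inside lo≤x x≤hi = cong₂ _+_ (m≤n⇒m∸n≡0 lo≤x) (m≤n⇒m∸n≡0 x≤hi)

distToRange-suc : ∀ lo hi x → distToRange lo hi x ≤ distToRange lo hi (suc x) + 1
distToRange-suc lo hi x = begin
  (lo ∸ x) + (x ∸ hi)                     ≤⟨ +-mono-≤ (m∸n≤m∸[1+n]+1 lo x) (∸-monoˡ-≤ hi (n≤1+n x)) ⟩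
  (lo ∸ suc x) + 1 + (suc x ∸ hi)         ≡⟨ xy∙z≈xz∙y (lo ∸ suc x) 1 (suc x ∸ hi) ⟩
  (lo ∸ suc x) + (suc x ∸ hi) + 1         ∎
  where open ≤-Reasoning


-- Fibonacci numbers

fib[n]≤fib[1+n] : ∀ n → fib n ≤ fib (suc n)
fib[n]≤fib[1+n] zero    = z≤n
fib[n]≤fib[1+n] (suc n) = m≤m+n (fib (suc n)) (fib n)

fib-mono-≤ : ∀ {m n} → m ≤ n → fib m ≤ fib n
fib-mono-≤ {m} m≤n with m≤n⇒∃[o]m+o≡n m≤n
... | o , refl = go o
  where
  go : ∀ o → fib m ≤ fib (m + o)
  go zero    = ≤-reflexive (cong fib (sym (+-identityʳ m)))
  go (suc o) = ≤-trans (go o) (≤-trans (fib[n]≤fib[1+n] (m + o)) (≤-reflexive (cong fib (sym (+-suc m o)))))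

fib[2+n]≤2*fib[1+n] : ∀ n → fib (2 + n) ≤ 2 * fib (1 + n)
fib[2+n]≤2*fib[1+n] n = begin
  fib (1 + n) + fib n             ≤⟨ +-monoʳ-≤ (fib (1 + n)) (fib[n]≤fib[1+n] n) ⟩
  fib (1 + n) + fib (1 + n)       ≡⟨ cong (fib (1 + n) +_) (+-identityʳ (fib (1 + n))) ⟨
  2 * fib (1 + n)                 ∎
  where open ≤-Reasoning

fib[1+t+n]≤2^t*fib[1+n] : ∀ t n → fib (suc (t + n)) ≤ 2 ^ t * fib (suc n)
fib[1+t+n]≤2^t*fib[1+n] zero    n = ≤-reflexive (sym (+-identityʳ (fib (suc n))))
fib[1+t+n]≤2^t*fib[1+n] (suc t) n = begin
  fib (2 + (t + n))               ≤⟨ fib[2+n]≤2*fib[1+n] (t + n) ⟩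
  2 * fib (1 + (t + n))           ≤⟨ *-monoʳ-≤ 2 (fib[1+t+n]≤2^t*fib[1+n] t n) ⟩
  2 * (2 ^ t * fib (suc n))       ≡⟨ *-assoc 2 (2 ^ t) (fib (suc n)) ⟨
  2 ^ suc t * fib (suc n)         ∎
  where open ≤-Reasoning

2*n≤fib[3+n] : ∀ n → 2 * n ≤ fib (3 + n)
2*n≤fib[3+n] zero          = z≤n
2*n≤fib[3+n] (suc zero)    = m≤m+n 2 1
2*n≤fib[3+n] (suc (suc n)) = begin
  2 * (2 + n)                     ≡⟨ *-distribˡ-+ 2 1 (suc n) ⟩
  2 + 2 * (1 + n)                 ≡⟨ +-comm 2 _ ⟩
  2 * (1 + n) + 2                 ≤⟨ +-mono-≤ (2*n≤fib[3+n] (suc n)) (fib-mono-≤ (m≤m+n 3 n)) ⟩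
  fib (4 + n) + fib (3 + n)       ∎
  where open ≤-Reasoning

2^⌊n/2⌋≤fib[1+n] : ∀ n → 2 ^ ⌊ n /2⌋ ≤ fib (suc n)
2^⌊n/2⌋≤fib[1+n] zero          = ≤-refl
2^⌊n/2⌋≤fib[1+n] (suc zero)    = ≤-refl
2^⌊n/2⌋≤fib[1+n] (suc (suc n)) = begin
  2 * 2 ^ ⌊ n /2⌋                 ≤⟨ *-monoʳ-≤ 2 (2^⌊n/2⌋≤fib[1+n] n) ⟩
  2 * fib (1 + n)                 ≡⟨ cong (fib (1 + n) +_) (+-identityʳ (fib (1 + n))) ⟩
  fib (1 + n) + fib (1 + n)       ≤⟨ +-monoˡ-≤ (fib (1 + n)) (fib[n]≤fib[1+n] (1 + n)) ⟩
  fib (3 + n)                     ∎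
  where open ≤-Reasoning

n≤2*⌊n/2⌋+1 : ∀ n → n ≤ 2 * ⌊ n /2⌋ + 1
n≤2*⌊n/2⌋+1 zero          = z≤n
n≤2*⌊n/2⌋+1 (suc zero)    = ≤-refl
n≤2*⌊n/2⌋+1 (suc (suc n)) =
  ≤-trans (s≤s (s≤s (n≤2*⌊n/2⌋+1 n))) (≤-reflexive (cong (_+ 1) (sym (*-suc 2 ⌊ n /2⌋))))

fib-index-≤-log : ∀ k {n} → fib (suc k) ≤ n → suc k ≤ 2 * ⌊log₂ n ⌋ + 2
fib-index-≤-log k {n} fib≤n = begin
  suc k                   ≤⟨ s≤s (n≤2*⌊n/2⌋+1 k) ⟩
  suc (2 * ⌊ k /2⌋ + 1)   ≡⟨ +-suc (2 * ⌊ k /2⌋) 1 ⟨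
  2 * ⌊ k /2⌋ + 2         ≤⟨ +-monoˡ-≤ 2 (*-monoʳ-≤ 2 half≤log) ⟩
  2 * ⌊log₂ n ⌋ + 2       ∎
  where
  open ≤-Reasoning
  half≤log : ⌊ k /2⌋ ≤ ⌊log₂ n ⌋
  half≤log = subst (_≤ ⌊log₂ n ⌋) (⌊log₂[2^n]⌋≡n ⌊ k /2⌋)
               (⌊log₂⌋-mono-≤ (≤-trans (2^⌊n/2⌋≤fib[1+n] k) fib≤n))

fib-square-step : ∀ n → fib (2 + n) * fib (2 + n) + fib (1 + n) * fib (1 + n)
                    ≡ fib (1 + n) * fib (3 + n) + fib n * fib (2 + n)
fib-square-step n = identity (fib n) (fib (1 + n))
  where
  identity : ∀ p q → (q + p) * (q + p) + q * q ≡ q * (q + p + q) + p * (q + p)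
  identity = solve-∀

cassini : ∀ n → fib (1 + n) * fib (1 + n) + 1 ≡ fib n * fib (2 + n)
              ⊎ fib (1 + n) * fib (1 + n) ≡ fib n * fib (2 + n) + 1
cassini zero    = inj₂ refl
cassini (suc n) with cassini n
... | inj₁ q²+1≡pr = inj₂ (+-exchange (fib-square-step n) q²+1≡pr)
... | inj₂ q²≡pr+1 = inj₁ (sym (+-exchange (sym (fib-square-step n)) (sym q²≡pr+1)))

module FibonacciProducts (k : ℕ) where

  F : ℕ → ℕ
  F i = fib (i + k)

  F₁²≤F₀F₂+1 : F 1 * F 1 ≤ F 0 * F 2 + 1
  F₁²≤F₀F₂+1 with cassini k
  ... | inj₁ q²+1≡pr = ≤-trans (m≤m+n _ 1) (≤-trans (≤-reflexive q²+1≡pr) (m≤m+n _ 1))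
  ... | inj₂ q²≡pr+1 = ≤-reflexive q²≡pr+1

  F₀F₂≤F₁²+1 : F 0 * F 2 ≤ F 1 * F 1 + 1
  F₀F₂≤F₁²+1 with cassini k
  ... | inj₁ q²+1≡pr = ≤-reflexive (sym q²+1≡pr)
  ... | inj₂ q²≡pr+1 = ≤-trans (m≤m+n _ 1) (≤-trans (≤-reflexive (sym q²≡pr+1)) (m≤m+n _ 1))

  F₂F₁≤F₀F₃+1 : F 2 * F 1 ≤ F 0 * F 3 + 1
  F₂F₁≤F₀F₃+1 = ≤-from-gap F₁²≤F₀F₂+1 (identity (F 0) (F 1))
    where
    identity : ∀ p q → (q + p) * q + 1 * (p * (q + p)) ≡ p * (q + p + q) + 1 * (q * q)
    identity = solve-∀

  F₀F₄≤F₂²+1 : F 0 * F 4 ≤ F 2 * F 2 + 1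
  F₀F₄≤F₂²+1 = ≤-from-gap F₀F₂≤F₁²+1 (identity (F 0) (F 1))
    where
    identity : ∀ p q → p * (q + p + q + (q + p)) + 1 * (q * q) ≡ (q + p) * (q + p) + 1 * (p * (q + p))
    identity = solve-∀

  F₂²≤F₁F₃+1 : F 2 * F 2 ≤ F 1 * F 3 + 1
  F₂²≤F₁F₃+1 = ≤-from-gap F₀F₂≤F₁²+1 (identity (F 0) (F 1))
    where
    identity : ∀ p q → (q + p) * (q + p) + 1 * (q * q) ≡ q * (q + p + q) + 1 * (p * (q + p))
    identity = solve-∀

  F₁F₄≤F₂F₃+1 : F 1 * F 4 ≤ F 2 * F 3 + 1
  F₁F₄≤F₂F₃+1 = ≤-from-gap F₁²≤F₀F₂+1 (identity (F 0) (F 1))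
    where
    identity : ∀ p q → q * (q + p + q + (q + p)) + 1 * (p * (q + p)) ≡ (q + p) * (q + p + q) + 1 * (q * q)
    identity = solve-∀

  F₀F₅≤F₂F₃+2 : F 0 * F 5 ≤ F 2 * F 3 + 2
  F₀F₅≤F₂F₃+2 = ≤-from-gap F₀F₂≤F₁²+1 (identity (F 0) (F 1))
    where
    identity : ∀ p q → p * (q + p + q + (q + p) + (q + p + q)) + 2 * (q * q)
                     ≡ (q + p) * (q + p + q) + 2 * (p * (q + p))
    identity = solve-∀

  F₁F₅≤F₂F₄+2 : F 1 * F 5 ≤ F 2 * F 4 + 2
  F₁F₅≤F₂F₄+2 = ≤-from-gap F₁²≤F₀F₂+1 (identity (F 0) (F 1))
    where
    identity : ∀ p q → q * (q + p + q + (q + p) + (q + p + q)) + 2 * (p * (q + p))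
                     ≡ (q + p) * (q + p + q + (q + p)) + 2 * (q * q)
    identity = solve-∀


-- Splitting in Fibonacci proportion

proportional-lower : ∀ {c r s x} → c ≤ r → r ≤ s + 1 → c * s < r * x + r → c ≤ x + 1
proportional-lower {c} {r} {s} {x} c≤r r≤s+1 cs<rx+r =
  subst (c ≤_) (+-comm 1 x) (s≤s⁻¹ (*-cancelˡ-< r c (2 + x) (begin-strict
    r * c            ≤⟨ ≤-reflexive (*-comm r c) ⟩
    c * r            ≤⟨ *-monoʳ-≤ c r≤s+1 ⟩
    c * (s + 1)      ≡⟨ solve (c ∷ s ∷ []) ⟩
    c * s + c        <⟨ +-monoˡ-< c cs<rx+r ⟩
    r * x + r + c    ≤⟨ +-monoʳ-≤ (r * x + r) c≤r ⟩
    r * x + r + r    ≡⟨ solve (r ∷ x ∷ []) ⟩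
    r * (2 + x)      ∎)))
  where open ≤-Reasoning

proportional-upper : ∀ {c r s x A G} → r * x < c * s + r → s ≤ G + 2 → c * G ≤ r * A + 2 →
                     suc c ≤ r → x ≤ A + 2
proportional-upper {c} {r} {s} {x} {A} {G} rx<cs+r s≤G+2 cG≤rA+2 c<r =
  subst (x ≤_) (+-comm 2 A) (s≤s⁻¹ (*-cancelˡ-< r x (3 + A) (begin-strict
    r * x                      <⟨ rx<cs+r ⟩
    c * s + r                  ≤⟨ +-monoˡ-≤ r (*-monoʳ-≤ c s≤G+2) ⟩
    c * (G + 2) + r            ≡⟨ solve (c ∷ G ∷ r ∷ []) ⟩
    c * G + 2 * c + r          ≤⟨ +-monoˡ-≤ r (+-monoˡ-≤ (2 * c) cG≤rA+2) ⟩
    r * A + 2 + 2 * c + r      ≡⟨ solve (r ∷ A ∷ c ∷ []) ⟩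
    r * A + 2 * suc c + r      ≤⟨ +-monoˡ-≤ r (+-monoʳ-≤ (r * A) (*-monoʳ-≤ 2 c<r)) ⟩
    r * A + 2 * r + r          ≡⟨ solve (r ∷ A ∷ []) ⟩
    r * (3 + A)                ∎)))
  where open ≤-Reasoning

-- With F i = F_{k+i}, the set S_{k+2} of size s is split into a ≈ s F₀ / F₂ and
-- b ≈ s F₁ / F₂ elements.
module ProportionalSplit (k : ℕ) (3≤k : 3 ≤ k) {s a b : ℕ} (a+b≡s : a + b ≡ s)
  (propL : fib (2 + k) * a < fib k * s + fib (2 + k))
  (propR : fib k * s < fib (2 + k) * a + fib (2 + k))
  (s-lower : fib (2 + k) ≤ s + 1) (s-upper : s ≤ fib (5 + k) + 2) where

  open FibonacciProducts k

  4≤F₂ : 4 ≤ F 2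
  4≤F₂ = ≤-trans (n≤1+n 4) (fib-mono-≤ (+-monoʳ-≤ 2 3≤k))

  F₂a+F₂b≡F₁s+F₀s : F 2 * a + F 2 * b ≡ F 1 * s + F 0 * s
  F₂a+F₂b≡F₁s+F₀s =
    trans (sym (*-distribˡ-+ (F 2) a b)) (trans (cong (F 2 *_) a+b≡s) (*-distribʳ-+ s (F 1) (F 0)))

  propL-b : F 2 * b < F 1 * s + F 2
  propL-b = +-cancelˡ-< (F 2 * a) (F 2 * b) (F 1 * s + F 2) (begin-strict
    F 2 * a + F 2 * b        ≡⟨ F₂a+F₂b≡F₁s+F₀s ⟩
    F 1 * s + F 0 * s        <⟨ +-monoʳ-< (F 1 * s) propR ⟩
    F 1 * s + (F 2 * a + F 2) ≡⟨ x∙yz≈y∙xz (F 1 * s) (F 2 * a) (F 2) ⟩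
    F 2 * a + (F 1 * s + F 2) ∎)
    where open ≤-Reasoning

  propR-b : F 1 * s < F 2 * b + F 2
  propR-b = +-cancelˡ-< (F 0 * s) (F 1 * s) (F 2 * b + F 2) (begin-strict
    F 0 * s + F 1 * s        ≡⟨ +-comm (F 0 * s) (F 1 * s) ⟩
    F 1 * s + F 0 * s        ≡⟨ F₂a+F₂b≡F₁s+F₀s ⟨
    F 2 * a + F 2 * b        <⟨ +-monoˡ-< (F 2 * b) propL ⟩
    F 0 * s + F 2 + F 2 * b  ≡⟨ xy∙z≈x∙zy (F 0 * s) (F 2) (F 2 * b) ⟩
    F 0 * s + (F 2 * b + F 2) ∎)
    where open ≤-Reasoning

  a-lower : F 0 ≤ a + 1
  a-lower = proportional-lower (fib-mono-≤ (m≤n+m k 2)) s-lower propR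

  b-lower : F 1 ≤ b + 1
  b-lower = proportional-lower (fib[n]≤fib[1+n] (1 + k)) s-lower propR-b

  a-upper : a ≤ F 3 + 2
  a-upper = proportional-upper propL s-upper F₀F₅≤F₂F₃+2
              (+-monoˡ-≤ (F 0) (fib-mono-≤ {1} {1 + k} (s≤s z≤n)))

  b-upper : b ≤ F 4 + 2
  b-upper = proportional-upper propL-b s-upper F₁F₅≤F₂F₄+2
              (subst (_≤ F 2) (+-comm (F 1) 1) (+-monoʳ-≤ (F 1) (fib-mono-≤ {1} {k} (≤-trans (s≤s z≤n) 3≤k))))

  -- Cassini's identity aligns the targets (F₂ F₁ ≈ F₀ F₃, F₀ F₄ ≈ F₂², …), so each
  -- deviation of a or b is, up to F₂ + 1, an F₀/F₂ or F₁/F₂ share of a deviation of s;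
  -- the shares add up because F₀ + F₁ = F₂.
  deviation : distToRange (F 1) (F 2) a + distToRange (F 2) (F 3) b ≤ distToRange (F 3) (F 4) s + 5
  deviation = *-cancelˡ-≤ (F 2) {{>-nonZero (≤-trans (s≤s z≤n) 4≤F₂)}} (begin
    F 2 * ((F 1 ∸ a) + (a ∸ F 2) + ((F 2 ∸ b) + (b ∸ F 3)))
      ≡⟨ distrib (F 2) (F 1 ∸ a) (a ∸ F 2) (F 2 ∸ b) (b ∸ F 3) ⟩
    F 2 * (F 1 ∸ a) + F 2 * (a ∸ F 2) + (F 2 * (F 2 ∸ b) + F 2 * (b ∸ F 3))
      ≤⟨ +-mono-≤ (+-mono-≤ below-a above-a) (+-mono-≤ below-b above-b) ⟩
    F 0 * X + (1 + F 2) + (F 0 * Y + (F 2 + 1)) + (F 1 * X + (1 + F 2) + (F 1 * Y + (F 2 + 1)))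
      ≡⟨ collect (F 0) (F 1) X Y ⟩
    F 2 * (X + Y) + 4 * F 2 + 4
      ≤⟨ +-monoʳ-≤ (F 2 * (X + Y) + 4 * F 2) 4≤F₂ ⟩
    F 2 * (X + Y) + 4 * F 2 + F 2
      ≡⟨ factor (F 2) (X + Y) ⟩
    F 2 * (X + Y + 5) ∎)
    where
    open ≤-Reasoning
    X Y : ℕ
    X = F 3 ∸ s
    Y = s ∸ F 4
    below-a : F 2 * (F 1 ∸ a) ≤ F 0 * X + (1 + F 2)
    below-a = *-∸-transfer (F 2) (F 0) (F 1) a (F 3) s F₂F₁≤F₀F₃+1 (<⇒≤ propR)
    above-a : F 2 * (a ∸ F 2) ≤ F 0 * Y + (F 2 + 1)
    above-a = *-∸-transfer (F 2) (F 0) a (F 2) s (F 4) (<⇒≤ propL) F₀F₄≤F₂²+1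
    below-b : F 2 * (F 2 ∸ b) ≤ F 1 * X + (1 + F 2)
    below-b = *-∸-transfer (F 2) (F 1) (F 2) b (F 3) s F₂²≤F₁F₃+1 (<⇒≤ propR-b)
    above-b : F 2 * (b ∸ F 3) ≤ F 1 * Y + (F 2 + 1)
    above-b = *-∸-transfer (F 2) (F 1) b (F 3) s (F 4) (<⇒≤ propL-b) F₁F₄≤F₂F₃+1
    distrib : ∀ r u v w z → r * (u + v + (w + z)) ≡ r * u + r * v + (r * w + r * z)
    distrib = solve-∀
    collect : ∀ p q X Y → p * X + (1 + (q + p)) + (p * Y + ((q + p) + 1))
                            + (q * X + (1 + (q + p)) + (q * Y + ((q + p) + 1)))
                          ≡ (q + p) * (X + Y) + 4 * (q + p) + 4
    collect = solve-∀
    factor : ∀ r z → r * z + 4 * r + r ≡ r * (z + 5)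
    factor = solve-∀


sumTo : (ℕ → ℕ) → ℕ → ℕ
sumTo f zero    = 0
sumTo f (suc n) = sumTo f n + f n

sumTo-cong : ∀ {f g} n → (∀ k → k < n → f k ≡ g k) → sumTo f n ≡ sumTo g n
sumTo-cong zero    _   = refl
sumTo-cong (suc n) f≡g = cong₂ _+_ (sumTo-cong n (λ k k<n → f≡g k (m<n⇒m<1+n k<n))) (f≡g n ≤-refl)

sumTo-mono : ∀ {f g} n → (∀ k → f k ≤ g k) → sumTo f n ≤ sumTo g n
sumTo-mono zero    _   = z≤n
sumTo-mono (suc n) f≤g = +-mono-≤ (sumTo-mono n f≤g) (f≤g n)

sumTo-+ : ∀ f g n → sumTo (λ k → f k + g k) n ≡ sumTo f n + sumTo g n
sumTo-+ f g zero    = refl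
sumTo-+ f g (suc n) =
  trans (cong (_+ (f n + g n)) (sumTo-+ f g n)) (interchange (sumTo f n) (sumTo g n) (f n) (g n))

sumTo-≤-length : ∀ {f} n → (∀ k → f k ≤ 1) → sumTo f n ≤ n
sumTo-≤-length         zero    _   = z≤n
sumTo-≤-length {f} (suc n) f≤1 =
  subst (sumTo f (suc n) ≤_) (+-comm n 1) (+-mono-≤ (sumTo-≤-length n f≤1) (f≤1 n))

sumTo-split : ∀ f m n → sumTo f (m + n) ≡ sumTo f n + sumTo (λ k → f (k + n)) m
sumTo-split f zero    n = sym (+-identityʳ (sumTo f n))
sumTo-split f (suc m) n = trans (cong (_+ f (m + n)) (sumTo-split f m n)) (+-assoc (sumTo f n) _ (f (m + n)))

sumTo-zeros : ∀ {f} n → (∀ k → k < n → f k ≡ 0) → sumTo f n ≡ 0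
sumTo-zeros zero    _   = refl
sumTo-zeros (suc n) f≡0 =
  cong₂ _+_ (sumTo-zeros n (λ k k<n → f≡0 k (m<n⇒m<1+n k<n))) (f≡0 n ≤-refl)

sumTo-agree-above : ∀ {f g} n → sumTo f n ≡ sumTo g n → (∀ k → n ≤ k → f k ≡ g k) →
                    ∀ k → n ≤ k → sumTo f k ≡ sumTo g k
sumTo-agree-above n eq _ zero z≤n = eq
sumTo-agree-above n eq f≡g (suc k) n≤1+k with m≤n⇒m<n∨m≡n n≤1+k
... | inj₂ refl      = eq
... | inj₁ (s≤s n≤k) = cong₂ _+_ (sumTo-agree-above n eq f≡g k n≤k) (f≡g k n≤k)

windowSum : (ℕ → ℕ) → ℕ → ℕ → ℕ
windowSum f x w = sumTo (λ k → f (k + x)) w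

AgreeOutside : (ℕ → ℕ) → (ℕ → ℕ) → ℕ → ℕ → Set
AgreeOutside f g x w = ∀ k → k < x ⊎ w + x ≤ k → f k ≡ g k

window-view : ∀ k x w → k < x ⊎ Σ ℕ (λ o → o < w × o + x ≡ k) ⊎ w + x ≤ k
window-view k x w with k <? x
... | yes k<x = inj₁ k<x
... | no k≮x with m≤n⇒∃[o]m+o≡n (≮⇒≥ k≮x)
...   | o , refl with o <? w
...     | yes o<w = inj₂ (inj₁ (o , o<w , +-comm o x))
...     | no o≮w  = inj₂ (inj₂ (≤-trans (+-monoˡ-≤ x (≮⇒≥ o≮w)) (≤-reflexive (+-comm o x))))

outside-≢ : ∀ {k} x w → k < x ⊎ w + x ≤ k → ∀ o → o < w → k ≢ o + x
outside-≢ x w (inj₁ k<x)   o _   = <⇒≢ (<-≤-trans k<x (m≤n+m x o))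
outside-≢ x w (inj₂ w+x≤k) o o<w = >⇒≢ (<-≤-trans (+-monoˡ-< x o<w) w+x≤k)

sumTo-window : ∀ {f g} x w → AgreeOutside f g x w → ∀ t →
               sumTo g (t + (w + x)) + windowSum f x w ≡ sumTo f (t + (w + x)) + windowSum g x w
sumTo-window {f} {g} x w agree t = begin
  sumTo g (t + (w + x)) + W f                   ≡⟨ cong (_+ W f) (split g) ⟩
  sumTo g x + W g + tail g + W f                ≡⟨ cong₂ (λ a b → a + W g + b + W f) (sym same-below) (sym same-above) ⟩
  sumTo f x + W g + tail f + W f                ≡⟨ swap (sumTo f x) (W g) (tail f) (W f) ⟩
  sumTo f x + W f + tail f + W g                ≡⟨ cong (_+ W g) (split f) ⟨
  sumTo f (t + (w + x)) + W g                   ∎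
  where
  open ≡-Reasoning
  W : (ℕ → ℕ) → ℕ
  W h = windowSum h x w
  tail : (ℕ → ℕ) → ℕ
  tail h = sumTo (λ k → h (k + (w + x))) t
  split : ∀ h → sumTo h (t + (w + x)) ≡ sumTo h x + W h + tail h
  split h = trans (sumTo-split h t (w + x)) (cong (_+ tail h) (sumTo-split h w x))
  same-below : sumTo f x ≡ sumTo g x
  same-below = sumTo-cong x (λ k k<x → agree k (inj₁ k<x))
  same-above : tail f ≡ tail g
  same-above = sumTo-cong t (λ k _ → agree (k + (w + x)) (inj₂ (m≤n+m (w + x) k)))
  swap : ∀ a b c d → a + b + c + d ≡ a + d + c + b
  swap = solve-∀

sumTo-window-≤ : ∀ {f g} x w {c d} → AgreeOutside f g x w →
                 windowSum g x w + d ≤ windowSum f x w + c →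
                 ∀ t → sumTo g (t + (w + x)) + d ≤ sumTo f (t + (w + x)) + c
sumTo-window-≤ {f} {g} x w {c} {d} agree window≤ t = +-cancelʳ-≤ (windowSum f x w) _ _ (begin
  sumTo g N + d + windowSum f x w         ≡⟨ xy∙z≈xz∙y (sumTo g N) d _ ⟩
  sumTo g N + windowSum f x w + d         ≡⟨ cong (_+ d) (sumTo-window x w agree t) ⟩
  sumTo f N + windowSum g x w + d         ≡⟨ +-assoc (sumTo f N) _ d ⟩
  sumTo f N + (windowSum g x w + d)       ≤⟨ +-monoʳ-≤ (sumTo f N) window≤ ⟩
  sumTo f N + (windowSum f x w + c)       ≡⟨ x∙yz≈xz∙y (sumTo f N) _ c ⟩
  sumTo f N + c + windowSum f x w         ∎)
  where
  open ≤-Reasoning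
  N : ℕ
  N = t + (w + x)


-- The potential of a size profile

-- A profile lists the slot sizes i ↦ |Sᵢ|.  φᵢ depends only on |Sᵢ| and
-- ↑ᵢ = Σ_{k<i} |S_k|: slotPotential i s u is φᵢ for |Sᵢ| = s and ↑ᵢ = u.
Profile : Set
Profile = ℕ → ℕ

nz-≤ : ∀ x y → nz x y ≤ y
nz-≤ zero    y = z≤n
nz-≤ (suc x) y = ≤-refl

upTerm : ℕ → ℕ → ℕ → ℕ
upTerm (suc (suc (suc j))) s u = nz s (fib j ∸ u)
upTerm _                   _ _ = 0

sizeTerm : ℕ → ℕ → ℕ
sizeTerm i s = nz s (distToRange (fib (1 + i)) (fib (2 + i)) s)

slotPotential : (i s u : ℕ) → ℕ
slotPotential i s u = upTerm i s u + sizeTerm i s + nz s 1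

potentialAt : Profile → ℕ → ℕ
potentialAt σ i = slotPotential i (σ i) (sumTo σ i)

potential : Profile → ℕ → ℕ
potential σ = sumTo (potentialAt σ)

nonemptyCount : Profile → ℕ → ℕ
nonemptyCount σ = sumTo (λ k → nz (σ k) 1)

slotPotential-empty : ∀ i u → slotPotential i 0 u ≡ 0
slotPotential-empty zero                u = refl
slotPotential-empty (suc zero)          u = refl
slotPotential-empty (suc (suc zero))    u = refl
slotPotential-empty (suc (suc (suc j))) u = refl

potentialAt-empty : ∀ σ k → σ k ≡ 0 → potentialAt σ k ≡ 0
potentialAt-empty σ k σk≡0 =
  trans (cong (λ s → slotPotential k s (sumTo σ k)) σk≡0) (slotPotential-empty k (sumTo σ k))

slotPotential-nonempty : ∀ j {s} u → 0 < s →
  slotPotential (3 + j) s u ≡ (fib j ∸ u) + distToRange (fib (4 + j)) (fib (5 + j)) s + 1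
slotPotential-nonempty j u (s≤s z≤n) = refl

slotPotential-balanced : ∀ j u → slotPotential (3 + j) (fib (4 + j)) u ≤ fib j + 1
slotPotential-balanced j u = begin
  nz F (fib j ∸ u) + sizeTerm (3 + j) F + nz F 1
    ≤⟨ +-mono-≤ (+-mono-≤ (≤-trans (nz-≤ F _) (m∸n≤m (fib j) u)) (nz-≤ F _)) (nz-≤ F 1) ⟩
  fib j + distToRange F (fib (5 + j)) F + 1
    ≡⟨ cong (λ d → fib j + d + 1) (distToRange-inside ≤-refl (fib[n]≤fib[1+n] (4 + j))) ⟩
  fib j + 0 + 1
    ≡⟨ cong (_+ 1) (+-identityʳ (fib j)) ⟩
  fib j + 1 ∎
  where
  open ≤-Reasoning
  F : ℕ
  F = fib (4 + j)

upTerm-suc-size : ∀ i s u → upTerm i s u ≤ upTerm i (suc s) u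
upTerm-suc-size (suc (suc (suc j))) zero    u = z≤n
upTerm-suc-size (suc (suc (suc j))) (suc s) u = ≤-refl
upTerm-suc-size zero                s       u = z≤n
upTerm-suc-size (suc zero)          s       u = z≤n
upTerm-suc-size (suc (suc zero))    s       u = z≤n

upTerm-suc-prefix : ∀ i s u → upTerm i s u ≤ upTerm i s (suc u) + nz s 1
upTerm-suc-prefix (suc (suc (suc j))) zero    u = z≤n
upTerm-suc-prefix (suc (suc (suc j))) (suc s) u = m∸n≤m∸[1+n]+1 (fib j) u
upTerm-suc-prefix zero                s       u = z≤n
upTerm-suc-prefix (suc zero)          s       u = z≤n
upTerm-suc-prefix (suc (suc zero))    s       u = z≤n

slotPotential-suc-size : ∀ i s u → slotPotential i s u ≤ slotPotential i (suc s) u + 1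
slotPotential-suc-size i s u = begin
  upTerm i s u + sizeTerm i s + nz s 1
    ≤⟨ +-mono-≤ (+-mono-≤ (upTerm-suc-size i s u) size≤) (nz-≤ s 1) ⟩
  upTerm i (suc s) u + (sizeTerm i (suc s) + 1) + 1
    ≡⟨ cong (_+ 1) (+-assoc (upTerm i (suc s) u) _ 1) ⟨
  upTerm i (suc s) u + sizeTerm i (suc s) + 1 + 1 ∎
  where
  open ≤-Reasoning
  size≤ : sizeTerm i s ≤ sizeTerm i (suc s) + 1
  size≤ = ≤-trans (nz-≤ s _) (distToRange-suc (fib (1 + i)) (fib (2 + i)) s)

slotPotential-suc-prefix : ∀ i s u → slotPotential i s u ≤ slotPotential i s (suc u) + nz s 1
slotPotential-suc-prefix i s u = begin
  upTerm i s u + sizeTerm i s + nz s 1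
    ≤⟨ +-monoˡ-≤ (nz s 1) (+-monoˡ-≤ (sizeTerm i s) (upTerm-suc-prefix i s u)) ⟩
  upTerm i s (suc u) + nz s 1 + sizeTerm i s + nz s 1
    ≡⟨ cong (_+ nz s 1) (xy∙z≈xz∙y (upTerm i s (suc u)) (nz s 1) (sizeTerm i s)) ⟩
  upTerm i s (suc u) + sizeTerm i s + nz s 1 + nz s 1 ∎
  where open ≤-Reasoning

potential-window : ∀ {σ τ} x w {c d} → AgreeOutside σ τ x w → sumTo σ (w + x) ≡ sumTo τ (w + x) →
  windowSum (potentialAt τ) x w + d ≤ windowSum (potentialAt σ) x w + c →
  ∀ t → potential τ (t + (w + x)) + d ≤ potential σ (t + (w + x)) + c
potential-window {σ} {τ} x w agree prefix≡ = sumTo-window-≤ x w agreeAt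
  where
  agreeAt : AgreeOutside (potentialAt σ) (potentialAt τ) x w
  agreeAt k (inj₁ k<x)   = cong₂ (slotPotential k) (agree k (inj₁ k<x))
    (sumTo-cong k (λ i i<k → agree i (inj₁ (<-trans i<k k<x))))
  agreeAt k (inj₂ w+x≤k) = cong₂ (slotPotential k) (agree k (inj₂ w+x≤k))
    (sumTo-agree-above (w + x) prefix≡ (λ i w+x≤i → agree i (inj₂ w+x≤i)) k w+x≤k)

nonemptyCount-≤ : ∀ σ M → (∀ k → 0 < σ k → k ≤ M) → ∀ n → nonemptyCount σ n ≤ suc M
nonemptyCount-≤ σ M bound zero    = z≤n
nonemptyCount-≤ σ M bound (suc n) with n ≤? M
... | yes n≤M = ≤-trans (sumTo-≤-length (suc n) (λ k → nz-≤ (σ k) 1)) (s≤s n≤M)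
... | no n≰M  = begin
  nonemptyCount σ n + nz (σ n) 1   ≡⟨ cong (λ s → nonemptyCount σ n + nz s 1) σn≡0 ⟩
  nonemptyCount σ n + 0            ≡⟨ +-identityʳ _ ⟩
  nonemptyCount σ n                ≤⟨ nonemptyCount-≤ σ M bound n ⟩
  suc M                            ∎
  where
  open ≤-Reasoning
  σn≡0 : σ n ≡ 0
  σn≡0 = n≤0⇒n≡0 (≮⇒≥ (λ 0<σn → n≰M (bound n 0<σn)))


-- The relaxed invariant

NoThreeNonempty : Profile → Set
NoThreeNonempty σ = ∀ k → 0 < σ k → 0 < σ (1 + k) → 0 < σ (2 + k) → ⊥

record RelaxedSize (k s : ℕ) : Set where
  field
    upper : s ≤ fib (3 + k) + 2
    lower : 3 < k → 0 < s → fib k ≤ s + 1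

RelaxedSize-empty : ∀ k → RelaxedSize k 0
RelaxedSize-empty k = record { upper = z≤n ; lower = λ _ () }

-- The size bounds of Inv with a slack of one below, because a removal may leave
-- S_j at F_j − 1 without an underflow, and of two above, from the rounding of a
-- proportional split.
record Relaxed (σ : Profile) : Set where
  field
    size    : ∀ k → RelaxedSize k (σ k)
    noThree : NoThreeNonempty σ

relaxed-frame : ∀ {σ τ} x w → AgreeOutside σ τ x w → (∀ o → o < w → RelaxedSize (o + x) (τ (o + x))) →
                NoThreeNonempty τ → Relaxed σ → Relaxed τ
relaxed-frame {σ} {τ} x w agree window noThree rel = record { size = size ; noThree = noThree }
  where
  size : ∀ k → RelaxedSize k (τ k)
  size k with window-view k x w
  ... | inj₁ k<x                     = subst (RelaxedSize k) (agree k (inj₁ k<x)) (Relaxed.size rel k)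
  ... | inj₂ (inj₁ (o , o<w , refl)) = window o o<w
  ... | inj₂ (inj₂ w+x≤k)            = subst (RelaxedSize k) (agree k (inj₂ w+x≤k)) (Relaxed.size rel k)

-- τ only changes slots between its empty slots z and w + z, which are at most three
-- apart, so every three consecutive slots are unchanged or contain one of them.
noThree-frame : ∀ {σ τ} z w → w ≤ 3 → AgreeOutside σ τ (suc z) w → τ z ≡ 0 → τ (w + z) ≡ 0 →
                NoThreeNonempty σ → NoThreeNonempty τ
noThree-frame {σ} {τ} z w w≤3 agree τz≡0 τw+z≡0 noThree k p₀ p₁ p₂ = contradiction
  where
  moved : ∀ i → i < suc z ⊎ w + suc z ≤ i → 0 < τ i → 0 < σ i
  moved i side = subst (0 <_) (sym (agree i side))

  hit : ∀ {c} → k ≤ c → c ≤ 2 + k → τ c ≡ 0 → ⊥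
  hit k≤c c≤2+k τc≡0 with m≤n⇒m<n∨m≡n k≤c
  ... | inj₂ refl = n>0⇒n≢0 p₀ τc≡0
  ... | inj₁ k<c with m≤n⇒m<n∨m≡n k<c
  ...   | inj₂ refl = n>0⇒n≢0 p₁ τc≡0
  ...   | inj₁ 1+k<c with ≤-antisym c≤2+k 1+k<c
  ...     | refl = n>0⇒n≢0 p₂ τc≡0

  contradiction : ⊥
  contradiction with 2 + k ≤? z | w + suc z ≤? k
  ... | yes 2+k≤z | _ = noThree k (moved k (inj₁ (s≤s (≤-trans (m≤n+m k 2) 2+k≤z))) p₀)
                                  (moved (1 + k) (inj₁ (s≤s (≤-trans (n≤1+n (1 + k)) 2+k≤z))) p₁)
                                  (moved (2 + k) (inj₁ (s≤s 2+k≤z)) p₂)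
  ... | no _ | yes w+1+z≤k = noThree k (moved k (inj₂ w+1+z≤k) p₀)
                                       (moved (1 + k) (inj₂ (m≤n⇒m≤1+n w+1+z≤k)) p₁)
                                       (moved (2 + k) (inj₂ (m≤n⇒m≤1+n (m≤n⇒m≤1+n w+1+z≤k))) p₂)
  ... | no 2+k≰z | no w+1+z≰k with k ≤? z
  ...   | yes k≤z = hit k≤z (<⇒≤ (≰⇒> 2+k≰z)) τz≡0
  ...   | no k≰z  = hit (s≤s⁻¹ (subst (k <_) (+-suc w z) (≰⇒> w+1+z≰k)))
                        (≤-trans (+-monoˡ-≤ z w≤3) (+-monoʳ-≤ 2 (≰⇒> k≰z))) τw+z≡0

sumTo-fib-bound : ∀ {σ} → (∀ k → σ k ≤ fib (3 + k) + 2) → ∀ n → sumTo σ n ≤ fib (4 + n) + 2 * n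
sumTo-fib-bound         bound zero    = z≤n
sumTo-fib-bound {σ} bound (suc n) = begin
  sumTo σ n + σ n                            ≤⟨ +-mono-≤ (sumTo-fib-bound bound n) (bound n) ⟩
  fib (4 + n) + 2 * n + (fib (3 + n) + 2)    ≡⟨ identity (fib (4 + n)) (fib (3 + n)) n ⟩
  fib (4 + n) + fib (3 + n) + 2 * suc n      ∎
  where
  open ≤-Reasoning
  identity : ∀ a b n → a + 2 * n + (b + 2) ≡ a + b + 2 * suc n
  identity = solve-∀


-- Delete-Min on profiles

module RemoveMinProfile {σ τ : Profile} {j : ℕ}
  (dec : suc (τ j) ≡ σ j) (others : ∀ k → k ≢ j → τ k ≡ σ k) where

  prefix-below : ∀ k → k ≤ j → sumTo τ k ≡ sumTo σ k
  prefix-below k k≤j = sumTo-cong k (λ i i<k → others i (<⇒≢ (<-≤-trans i<k k≤j)))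

  prefix-above : ∀ k → j < k → suc (sumTo τ k) ≡ sumTo σ k
  prefix-above (suc k) (s≤s j≤k) with m≤n⇒m<n∨m≡n j≤k
  ... | inj₂ refl = trans (sym (+-suc (sumTo τ k) (τ k))) (cong₂ _+_ (prefix-below k ≤-refl) dec)
  ... | inj₁ j<k  = cong₂ _+_ (prefix-above k j<k) (others k (>⇒≢ j<k))

  potentialAt-decrement : ∀ k → potentialAt τ k ≤ potentialAt σ k + nz (σ k) 1
  potentialAt-decrement k with <-cmp k j
  ... | tri< k<j _ _ =
    ≤-trans (≤-reflexive (cong₂ (slotPotential k) (others k (<⇒≢ k<j)) (prefix-below k (<⇒≤ k<j)))) (m≤m+n _ _)
  ... | tri≈ _ refl _ = subst₂ (λ s u → potentialAt τ k ≤ slotPotential k s u + nz s 1)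
                          dec (prefix-below k ≤-refl)
                          (slotPotential-suc-size k (τ k) (sumTo τ k))
  ... | tri> _ _ j<k  = subst₂ (λ s u → potentialAt τ k ≤ slotPotential k s u + nz s 1)
                          (others k (>⇒≢ j<k)) (prefix-above k j<k)
                          (slotPotential-suc-prefix k (τ k) (sumTo τ k))

  potential-decrement : ∀ n → potential τ n ≤ potential σ n + nonemptyCount σ n
  potential-decrement n = ≤-trans (sumTo-mono n potentialAt-decrement)
                                  (≤-reflexive (sumTo-+ (potentialAt σ) (λ k → nz (σ k) 1) n))

module UnderflowUpProfile {σ τ : Profile} (m : ℕ)
  (underfull : σ (4 + m) ≡ fib (4 + m)) (σ₂≡0 : σ (2 + m) ≡ 0) (σ₃≡0 : σ (3 + m) ≡ 0)
  (moved : τ (3 + m) ≡ σ (4 + m)) (τ₄≡0 : τ (4 + m) ≡ 0) (agree : AgreeOutside σ τ (3 + m) 2) where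

  τ₃≡F : τ (3 + m) ≡ fib (4 + m)
  τ₃≡F = trans moved underfull

  prefix : sumTo σ (5 + m) ≡ sumTo τ (5 + m)
  prefix = begin
    P + σ (3 + m) + σ (4 + m)         ≡⟨ cong (λ x → P + x + σ (4 + m)) σ₃≡0 ⟩
    P + 0 + σ (4 + m)                 ≡⟨ xy∙z≈xz∙y P 0 (σ (4 + m)) ⟩
    P + σ (4 + m) + 0                 ≡⟨ cong₂ _+_ (cong₂ _+_ P≡P′ (sym moved)) (sym τ₄≡0) ⟩
    sumTo τ (3 + m) + τ (3 + m) + τ (4 + m) ∎
    where
    open ≡-Reasoning
    P : ℕ
    P = sumTo σ (3 + m)
    P≡P′ : P ≡ sumTo τ (3 + m)
    P≡P′ = sumTo-cong (3 + m) (λ k k<x → agree k (inj₁ k<x))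

  window : windowSum (potentialAt τ) (3 + m) 2 + 0 ≤ windowSum (potentialAt σ) (3 + m) 2 + (fib m + 1)
  window = begin
    0 + potentialAt τ (3 + m) + potentialAt τ (4 + m) + 0
      ≡⟨ +-identityʳ (potentialAt τ (3 + m) + potentialAt τ (4 + m)) ⟩
    potentialAt τ (3 + m) + potentialAt τ (4 + m)
      ≡⟨ cong (potentialAt τ (3 + m) +_) (potentialAt-empty τ (4 + m) τ₄≡0) ⟩
    potentialAt τ (3 + m) + 0
      ≡⟨ +-identityʳ (potentialAt τ (3 + m)) ⟩
    slotPotential (3 + m) (τ (3 + m)) (sumTo τ (3 + m))
      ≡⟨ cong (λ s → slotPotential (3 + m) s (sumTo τ (3 + m))) τ₃≡F ⟩
    slotPotential (3 + m) (fib (4 + m)) (sumTo τ (3 + m))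
      ≤⟨ slotPotential-balanced m (sumTo τ (3 + m)) ⟩
    fib m + 1
      ≤⟨ m≤n+m (fib m + 1) (windowSum (potentialAt σ) (3 + m) 2) ⟩
    windowSum (potentialAt σ) (3 + m) 2 + (fib m + 1) ∎
    where open ≤-Reasoning

  potential-bound : ∀ t → potential τ (t + (5 + m)) ≤ potential σ (t + (5 + m)) + (fib m + 1)
  potential-bound t =
    ≤-trans (≤-reflexive (sym (+-identityʳ _))) (potential-window (3 + m) 2 agree prefix window t)

  relaxed : Relaxed σ → Relaxed τ
  relaxed rel = relaxed-frame (3 + m) 2 agree window-sizes
    (noThree-frame (2 + m) 2 (n≤1+n 2) agree τ₂≡0 τ₄≡0 (Relaxed.noThree rel)) rel
    where
    τ₂≡0 : τ (2 + m) ≡ 0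
    τ₂≡0 = trans (sym (agree (2 + m) (inj₁ ≤-refl))) σ₂≡0
    window-sizes : ∀ o → o < 2 → RelaxedSize (o + (3 + m)) (τ (o + (3 + m)))
    window-sizes 0 _ = subst (RelaxedSize (3 + m)) (sym τ₃≡F) (record
      { upper = ≤-trans (fib-mono-≤ (m≤n+m (4 + m) 2)) (m≤m+n _ 2)
      ; lower = λ _ _ → ≤-trans (fib[n]≤fib[1+n] (3 + m)) (m≤m+n _ 1) })
    window-sizes 1 _ = subst (RelaxedSize (4 + m)) (sym τ₄≡0) (RelaxedSize-empty (4 + m))
    window-sizes (suc (suc o)) (s≤s (s≤s ()))

-- A split-up of S_{12+m} costs at most F_{15+m} + 2 ≤ 256 F_{7+m} + 2 and lowers
-- Φ by F_{7+m} − 6 (SplitUpProfile.window).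
scale : ℕ
scale = 1000

module SplitUpProfile {σ τ : Profile} (m : ℕ) (rel : Relaxed σ)
  (gap : ∀ o → o < 9 → σ (o + (3 + m)) ≡ 0) (nonempty : 0 < σ (12 + m))
  (sizes : τ (10 + m) + τ (11 + m) ≡ σ (12 + m))
  (propL : fib (12 + m) * τ (10 + m) < fib (10 + m) * σ (12 + m) + fib (12 + m))
  (propR : fib (10 + m) * σ (12 + m) < fib (12 + m) * τ (10 + m) + fib (12 + m))
  (τ₁₂≡0 : τ (12 + m) ≡ 0) (agree : AgreeOutside σ τ (10 + m) 3) where

  s a b U : ℕ
  s = σ (12 + m)
  a = τ (10 + m)
  b = τ (11 + m)
  U = sumTo σ (3 + m)

  s-size : RelaxedSize (12 + m) s
  s-size = Relaxed.size rel (12 + m)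

  open ProportionalSplit (10 + m) (s≤s (s≤s (s≤s z≤n))) sizes propL propR
    (RelaxedSize.lower s-size (s≤s (s≤s (s≤s (s≤s z≤n)))) nonempty) (RelaxedSize.upper s-size)

  prefix-flat : ∀ o → o ≤ 9 → sumTo σ (o + (3 + m)) ≡ U
  prefix-flat o o≤9 = trans (sumTo-split σ o (3 + m))
    (trans (cong (U +_) (sumTo-zeros o (λ k k<o → gap k (<-≤-trans k<o o≤9)))) (+-identityʳ U))

  τ-prefix : sumTo τ (10 + m) ≡ U
  τ-prefix = trans (sym (sumTo-cong (10 + m) (λ k k<x → agree k (inj₁ k<x)))) (prefix-flat 7 (m≤m+n 7 2))

  prefix : sumTo σ (13 + m) ≡ sumTo τ (13 + m)
  prefix = begin
    sumTo σ (12 + m) + s         ≡⟨ cong (_+ s) (prefix-flat 9 ≤-refl) ⟩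
    U + s                        ≡⟨ cong (U +_) sizes ⟨
    U + (a + b)                  ≡⟨ +-assoc U a b ⟨
    U + a + b                    ≡⟨ +-identityʳ (U + a + b) ⟨
    U + a + b + 0                ≡⟨ cong₂ _+_ (cong (λ x → x + a + b) (sym τ-prefix)) (sym τ₁₂≡0) ⟩
    sumTo τ (12 + m) + τ (12 + m) ∎
    where open ≡-Reasoning

  U≤F₈ : U ≤ fib (8 + m)
  U≤F₈ = begin
    U                             ≤⟨ sumTo-fib-bound (λ k → RelaxedSize.upper (Relaxed.size rel k)) (3 + m) ⟩
    fib (7 + m) + 2 * (3 + m)     ≤⟨ +-monoʳ-≤ (fib (7 + m)) (2*n≤fib[3+n] (3 + m)) ⟩
    fib (8 + m)                   ∎
    where open ≤-Reasoning

  F₈≤a : fib (8 + m) ≤ a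
  F₈≤a = +-cancelʳ-≤ 1 (fib (8 + m)) a (begin
    fib (8 + m) + 1               ≡⟨ +-comm (fib (8 + m)) 1 ⟩
    1 + fib (8 + m)               ≤⟨ +-monoˡ-≤ (fib (8 + m)) (fib-mono-≤ {1} {9 + m} (s≤s z≤n)) ⟩
    fib (10 + m)                  ≤⟨ a-lower ⟩
    a + 1                         ∎)
    where open ≤-Reasoning

  a>0 : 0 < a
  a>0 = <-≤-trans (fib-mono-≤ {2} {8 + m} (s≤s (s≤s z≤n))) F₈≤a

  b>0 : 0 < b
  b>0 = s≤s⁻¹ (≤-trans (fib-mono-≤ {3} {11 + m} (s≤s (s≤s (s≤s z≤n))))
                       (subst (fib (11 + m) ≤_) (+-comm b 1) b-lower))

  F₇ dA dB dS : ℕ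
  F₇ = fib (7 + m)
  dA = distToRange (fib (11 + m)) (fib (12 + m)) a
  dB = distToRange (fib (12 + m)) (fib (13 + m)) b
  dS = distToRange (fib (13 + m)) (fib (14 + m)) s

  τ-at-10 : potentialAt τ (10 + m) ≡ (F₇ ∸ U) + dA + 1
  τ-at-10 = trans (slotPotential-nonempty (7 + m) (sumTo τ (10 + m)) a>0)
                  (cong (λ u → (F₇ ∸ u) + dA + 1) τ-prefix)

  τ-at-11 : potentialAt τ (11 + m) ≡ 0 + dB + 1
  τ-at-11 = trans (slotPotential-nonempty (8 + m) (sumTo τ (11 + m)) b>0)
                  (cong (λ u → u + dB + 1) (m≤n⇒m∸n≡0 F₈≤U+a))
    where
    F₈≤U+a : fib (8 + m) ≤ sumTo τ (11 + m)
    F₈≤U+a = ≤-trans F₈≤a (≤-trans (m≤n+m a U) (≤-reflexive (cong (_+ a) (sym τ-prefix))))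

  σ-at-12 : potentialAt σ (12 + m) ≡ (fib (9 + m) ∸ U) + dS + 1
  σ-at-12 = trans (slotPotential-nonempty (9 + m) (sumTo σ (12 + m)) nonempty)
                  (cong (λ u → (fib (9 + m) ∸ u) + dS + 1) (prefix-flat 9 ≤-refl))

  window : windowSum (potentialAt τ) (10 + m) 3 + F₇ ≤ windowSum (potentialAt σ) (10 + m) 3 + 6
  window = begin
    0 + potentialAt τ (10 + m) + potentialAt τ (11 + m) + potentialAt τ (12 + m) + F₇
      ≡⟨ cong₂ (λ x y → 0 + x + y + potentialAt τ (12 + m) + F₇) τ-at-10 τ-at-11 ⟩
    0 + ((F₇ ∸ U) + dA + 1) + (0 + dB + 1) + potentialAt τ (12 + m) + F₇
      ≡⟨ cong (λ x → 0 + ((F₇ ∸ U) + dA + 1) + (0 + dB + 1) + x + F₇) (potentialAt-empty τ (12 + m) τ₁₂≡0) ⟩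
    0 + ((F₇ ∸ U) + dA + 1) + (0 + dB + 1) + 0 + F₇
      ≡⟨ collect (F₇ ∸ U) dA dB F₇ ⟩
    ((F₇ ∸ U) + F₇) + (dA + dB) + 2
      ≤⟨ +-monoˡ-≤ 2 (+-mono-≤ (m∸o+m≤n+m∸o (fib[n]≤fib[1+n] (7 + m)) U≤F₈) deviation) ⟩
    (fib (9 + m) ∸ U) + (dS + 5) + 2
      ≡⟨ spread (fib (9 + m) ∸ U) dS ⟩
    0 + 0 + 0 + ((fib (9 + m) ∸ U) + dS + 1) + 6
      ≡⟨ cong (λ x → 0 + 0 + 0 + x + 6) σ-at-12 ⟨
    0 + 0 + 0 + potentialAt σ (12 + m) + 6
      ≡⟨ cong₂ (λ x y → 0 + x + y + potentialAt σ (12 + m) + 6)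
               (potentialAt-empty σ (10 + m) (gap 7 (m≤m+n 8 1))) (potentialAt-empty σ (11 + m) (gap 8 ≤-refl)) ⟨
    0 + potentialAt σ (10 + m) + potentialAt σ (11 + m) + potentialAt σ (12 + m) + 6 ∎
    where
    open ≤-Reasoning
    collect : ∀ d x y f → 0 + (d + x + 1) + (0 + y + 1) + 0 + f ≡ (d + f) + (x + y) + 2
    collect = solve-∀
    spread : ∀ d z → d + (z + 5) + 2 ≡ 0 + 0 + 0 + (d + z + 1) + 6
    spread = solve-∀

  paid : s + scale * 6 ≤ scale * fib (7 + m)
  paid = begin
    s + 6000                          ≤⟨ +-monoˡ-≤ 6000 (RelaxedSize.upper s-size) ⟩
    fib (15 + m) + 2 + 6000           ≤⟨ +-monoˡ-≤ 6000 (+-monoˡ-≤ 2 (fib[1+t+n]≤2^t*fib[1+n] 8 (6 + m))) ⟩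
    256 * F₇ + 2 + 6000               ≡⟨ +-assoc (256 * F₇) 2 6000 ⟩
    256 * F₇ + 6002                   ≤⟨ +-monoʳ-≤ (256 * F₇) (≤-trans (m≤m+n 6002 3670) (*-monoʳ-≤ 744 13≤F₇)) ⟩
    256 * F₇ + 744 * F₇               ≡⟨ *-distribʳ-+ F₇ 256 744 ⟨
    1000 * F₇                         ∎
    where
    open ≤-Reasoning
    13≤F₇ : 13 ≤ F₇
    13≤F₇ = fib-mono-≤ (m≤m+n 7 m)

  amortized : ∀ t → s + scale * potential τ (t + (13 + m)) ≤ scale * potential σ (t + (13 + m))
  amortized t = amortize {c = scale} {P = potential σ (t + (13 + m))} {P′ = potential τ (t + (13 + m))}
                         (potential-window (10 + m) 3 agree prefix window t) paid

  relaxed : Relaxed τ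
  relaxed = relaxed-frame (10 + m) 3 agree window-sizes
    (noThree-frame (9 + m) 3 ≤-refl agree τ₉≡0 τ₁₂≡0 (Relaxed.noThree rel)) rel
    where
    τ₉≡0 : τ (9 + m) ≡ 0
    τ₉≡0 = trans (sym (agree (9 + m) (inj₁ ≤-refl))) (gap 6 (m≤m+n 7 2))
    window-sizes : ∀ o → o < 3 → RelaxedSize (o + (10 + m)) (τ (o + (10 + m)))
    window-sizes 0 _ = record { upper = a-upper ; lower = λ _ _ → a-lower }
    window-sizes 1 _ = record { upper = b-upper ; lower = λ _ _ → b-lower }
    window-sizes 2 _ = subst (RelaxedSize (12 + m)) (sym τ₁₂≡0) (RelaxedSize-empty (12 + m))
    window-sizes (suc (suc (suc o))) (s≤s (s≤s (s≤s ())))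


module _ (O : StrictTotalOrder 0ℓ 0ℓ 0ℓ) where

  open FH O

  up≡sumTo : ∀ H i → up H i ≡ sumTo (size H) i
  up≡sumTo H zero    = refl
  up≡sumTo H (suc i) = cong (_+ size H i) (up≡sumTo H i)

  φ≡potentialAt : ∀ H i → φ H i ≡ potentialAt (size H) i
  φ≡potentialAt H zero                = refl
  φ≡potentialAt H (suc zero)          = refl
  φ≡potentialAt H (suc (suc zero))    = refl
  φ≡potentialAt H (suc (suc (suc j))) = cong (slotPotential (3 + j) (size H (3 + j))) (up≡sumTo H (3 + j))

  ΦUpTo≡potential : ∀ H n → ΦUpTo H n ≡ potential (size H) n
  ΦUpTo≡potential H zero    = refl
  ΦUpTo≡potential H (suc n) = cong₂ _+_ (ΦUpTo≡potential H n) (φ≡potentialAt H n)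

  slot-beyond : ∀ H k → length H ≤ k → slot H k ≡ []
  slot-beyond []      k       _         = refl
  slot-beyond (s ∷ H) (suc k) (s≤s len≤k) = slot-beyond H k len≤k

  Φ≡potential : ∀ H N → length H ≤ N → Φ H ≡ potential (size H) N
  Φ≡potential []      zero    _       = refl
  Φ≡potential (_ ∷ _) zero    ()
  Φ≡potential H       (suc N) len≤1+N with m≤n⇒m<n∨m≡n len≤1+N
  ... | inj₂ len≡1+N     = trans (ΦUpTo≡potential H (length H)) (cong (potential (size H)) len≡1+N)
  ... | inj₁ (s≤s len≤N) =
    trans (Φ≡potential H N len≤N) (sym (trans (cong (potential (size H) N +_) beyond) (+-identityʳ _)))
    where
    beyond : potentialAt (size H) N ≡ 0
    beyond = potentialAt-empty (size H) N (cong length (slot-beyond H N len≤N))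

  Φ-from-potential : ∀ H H′ n (R : ℕ → ℕ → Set) →
                     (∀ t → R (potential (size H) (t + n)) (potential (size H′) (t + n))) → R (Φ H) (Φ H′)
  Φ-from-potential H H′ n R holds = subst₂ R
    (sym (Φ≡potential H (t + n) (≤-trans (m≤m+n (length H) (length H′)) (m≤m+n t n))))
    (sym (Φ≡potential H′ (t + n) (≤-trans (m≤n+m (length H′) (length H)) (m≤m+n t n))))
    (holds t)
    where
    t : ℕ
    t = length H + length H′

  size≤elems : ∀ H k → size H k ≤ elems H
  size≤elems []      k       = z≤n
  size≤elems (s ∷ H) zero    = m≤m+n (length s) _
  size≤elems (s ∷ H) (suc k) = ≤-trans (size≤elems H k) (m≤n+m _ (length s))

  size≤fib : ∀ {H} → Inv H → ∀ k → size H k ≤ fib (3 + k)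
  size≤fib {H} inv k with 0 <? size H k
  ... | yes k-nonempty = ≤-trans (Inv.sizeMax inv k k-nonempty) (≤-reflexive (cong fib (+-comm k 3)))
  ... | no k-empty     = ≤-trans (≮⇒≥ k-empty) z≤n

  first-nonempty-≤11 : ∀ {H j} → Inv H → NonEmpty H j → (∀ k → k < j → Empty H k) → j ≤ 11
  first-nonempty-≤11 {H} {j} inv j-nonempty below with j ≤? 11
  ... | yes j≤11 = j≤11
  ... | no j≰11 with m≤n⇒∃[o]m+o≡n (≰⇒> j≰11)
  ...   | w , refl = ⊥-elim (n>0⇒n≢0 j-nonempty (cong length (subst (Empty H) (+-comm (3 + w) 9) run-of-nine)))
    where
    run-of-nine : Empty H (3 + w + 9)
    run-of-nine = Inv.emptyRuns inv (3 + w) (m≤m+n 3 w) (λ k k<9 →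
      below (3 + w + k) (subst (3 + w + k <_) (+-comm (3 + w) 9) (+-monoʳ-< (3 + w) k<9)))

  nonempty-index-≤ : ∀ {H} k → Inv H → NonEmpty H k → k ≤ 2 * ⌊log₂ elems H ⌋ + 3
  nonempty-index-≤ zero _ _ = z≤n
  nonempty-index-≤ {H} (suc k) inv k-nonempty with suc k ≤? 3
  ... | yes k≤3 = ≤-trans k≤3 (m≤n+m 3 _)
  ... | no k≰3  = ≤-trans (fib-index-≤-log k fib≤elems) (+-monoʳ-≤ _ (n≤1+n 2))
    where
    fib≤elems : fib (suc k) ≤ elems H
    fib≤elems = ≤-trans (Inv.sizeMin inv (suc k) (≰⇒> k≰3) k-nonempty) (size≤elems H (suc k))

  splitUp-amortized : ∀ {i H H₁ a} → SplitUp i H H₁ a → Relaxed (size H) →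
                      Relaxed (size H₁) × (a + scale * Φ H₁ ≤ scale * Φ H)
  splitUp-amortized {H = H} {H₁} {a} sp rel with m≤n⇒∃[o]m+o≡n (SplitUp.idx sp)
  ... | m , refl = S.relaxed , Φ-from-potential H H₁ (13 + m) (λ P P₁ → a + scale * P₁ ≤ scale * P)
                                 (λ t → ≤-trans (≤-reflexive (cong (_+ _) (SplitUp.cst sp))) (S.amortized t))
    where
    gap : ∀ o → o < 9 → size H (o + (3 + m)) ≡ 0
    gap o o<9 = cong length (subst (Empty H) index (SplitUp.empt sp (9 ∸ o) (m<n⇒0<n∸m o<9) (m∸n≤m 9 o)))
      where
      index : 12 + m ∸ (9 ∸ o) ≡ o + (3 + m)
      index = trans (+-∸-comm (3 + m) (m∸n≤m 9 o)) (cong (_+ (3 + m)) (m∸[m∸n]≡n (<⇒≤ o<9)))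
    sizes : size H₁ (10 + m) + size H₁ (11 + m) ≡ size H (12 + m)
    sizes = trans (sym (length-++ (slot H₁ (10 + m)))) (↭-length (SplitUp.perm sp))
    agree : AgreeOutside (size H) (size H₁) (10 + m) 3
    agree k out = sym (cong length (SplitUp.same sp k (outside 0 (s≤s z≤n))
                                      (outside 1 (s≤s (s≤s z≤n))) (outside 2 ≤-refl)))
      where
      outside : ∀ o → o < 3 → k ≢ o + (10 + m)
      outside = outside-≢ (10 + m) 3 out
    module S = SplitUpProfile m rel gap (SplitUp.ne sp) sizes (SplitUp.propL sp) (SplitUp.propR sp)
                 (cong length (SplitUp.newI sp)) agree

  mergeDown-impossible : ∀ {i H H₁ a} → MergeDown i H H₁ a → Relaxed (size H) → ⊥
  mergeDown-impossible md rel with m≤n⇒∃[o]m+o≡n (MergeDown.idx md) | MergeDown.ne md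
  ... | m , refl | p₀ , p₁ , p₂ = Relaxed.noThree rel (3 + m) p₀ p₁ p₂

  restore-amortized : ∀ {H H′ t} → Restore H H′ t → Relaxed (size H) → t + scale * Φ H′ ≤ scale * Φ H
  restore-amortized done _ = ≤-refl
  restore-amortized (step (merge _ md) _) rel = ⊥-elim (mergeDown-impossible md rel)
  restore-amortized {H} {H′} (step {H₁ = H₁} {a = a} {b = b} (split _ sp) rest) rel = begin
    a + b + scale * Φ H′       ≡⟨ +-assoc a b (scale * Φ H′) ⟩
    a + (b + scale * Φ H′)     ≤⟨ +-monoʳ-≤ a (restore-amortized rest (proj₁ split-step)) ⟩
    a + scale * Φ H₁           ≤⟨ proj₂ split-step ⟩
    scale * Φ H                ∎
    where
    open ≤-Reasoning
    split-step : Relaxed (size H₁) × (a + scale * Φ H₁ ≤ scale * Φ H)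
    split-step = splitUp-amortized sp rel

  underflowUp-amortized : ∀ {j H₁ H₂ t₂} → UnderflowUp j H₁ H₂ t₂ → j ≤ 11 → (∀ k → k < j → size H₁ k ≡ 0) →
                          Relaxed (size H₁) → t₂ ≤ 1 × Φ H₂ ≤ Φ H₁ + 14 × Relaxed (size H₂)
  underflowUp-amortized {H₁ = H₁} {H₂} uu j≤11 below rel with m≤n⇒∃[o]m+o≡n (UnderflowUp.idx uu)
  ... | m , refl = ≤-reflexive (UnderflowUp.cst uu) , potential-bound , U.relaxed rel
    where
    agree : AgreeOutside (size H₁) (size H₂) (3 + m) 2
    agree k out = sym (cong length (UnderflowUp.same uu k (outside 0 (s≤s z≤n)) (outside 1 ≤-refl)))
      where
      outside : ∀ o → o < 2 → k ≢ o + (3 + m)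
      outside = outside-≢ (3 + m) 2 out
    module U = UnderflowUpProfile m (UnderflowUp.under uu) (below (2 + m) (n≤1+n (3 + m)))
                 (cong length (UnderflowUp.prevE uu)) (cong length (UnderflowUp.newP uu))
                 (cong length (UnderflowUp.newI uu)) agree
    F≤13 : fib m ≤ 13
    F≤13 = fib-mono-≤ (+-cancelˡ-≤ 4 m 7 j≤11)
    potential-bound : Φ H₂ ≤ Φ H₁ + 14
    potential-bound = Φ-from-potential H₁ H₂ (5 + m) (λ P₁ P₂ → P₂ ≤ P₁ + 14)
                        (λ t → ≤-trans (U.potential-bound t) (+-monoʳ-≤ _ (+-monoˡ-≤ 1 F≤13)))

  underflowThru-impossible : ∀ {j H₁ H₂ t₂} → UnderflowThru j H₁ H₂ t₂ → (∀ k → k < j → size H₁ k ≡ 0) → ⊥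
  underflowThru-impossible ut below with m≤n⇒∃[o]m+o≡n (UnderflowThru.idx ut)
  ... | m , refl = n>0⇒n≢0 (UnderflowThru.prevNE ut) (below (4 + m) ≤-refl)

  module DeleteMinPhases {H H′ t} (inv : Inv H) (run : DeleteMinRun H H′ t) where

    open DeleteMinRun run public
    open RemoveMin removal using (firstNonEmpty; perm; new; same; cst)

    j-nonempty : NonEmpty H j
    j-nonempty = proj₁ firstNonEmpty

    j≤11 : j ≤ 11
    j≤11 = first-nonempty-≤11 inv j-nonempty (proj₂ firstNonEmpty)

    decrement : suc (size H₁ j) ≡ size H j
    decrement = trans (cong (λ xs → suc (length xs)) new) (sym (↭-length perm))

    unchanged : ∀ k → k ≢ j → size H₁ k ≡ size H k
    unchanged k k≢j = cong length (same k k≢j)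

    H₁-below : ∀ k → k < j → size H₁ k ≡ 0
    H₁-below k k<j = trans (unchanged k (<⇒≢ k<j)) (cong length (proj₂ firstNonEmpty k k<j))

    size₁≤size : ∀ k → size H₁ k ≤ size H k
    size₁≤size k with k ≟ j
    ... | yes refl = ≤-trans (n≤1+n _) (≤-reflexive decrement)
    ... | no k≢j   = ≤-reflexive (unchanged k k≢j)

    size≤size₁+1 : ∀ k → size H k ≤ size H₁ k + 1
    size≤size₁+1 k with k ≟ j
    ... | yes refl = ≤-reflexive (trans (sym decrement) (+-comm 1 _))
    ... | no k≢j   = ≤-trans (≤-reflexive (sym (unchanged k k≢j))) (m≤m+n _ 1)

    relaxed₁ : Relaxed (size H₁)
    relaxed₁ = record
      { size    = λ k → record
        { upper = ≤-trans (size₁≤size k) (≤-trans (size≤fib inv k) (m≤m+n _ 2))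
        ; lower = λ 3<k k-nonempty →
            ≤-trans (Inv.sizeMin inv k 3<k (<-≤-trans k-nonempty (size₁≤size k))) (size≤size₁+1 k) }
      ; noThree = λ k p₀ p₁ p₂ → Inv.nonemptyRuns inv k
          (<-≤-trans p₀ (size₁≤size k) , <-≤-trans p₁ (size₁≤size (1 + k)) , <-≤-trans p₂ (size₁≤size (2 + k))) }

    removal-cost : t₁ ≤ 377
    removal-cost =
      subst (_≤ 377) (sym cst) (≤-trans (Inv.sizeMax inv j j-nonempty) (fib-mono-≤ (+-monoˡ-≤ 3 j≤11)))

    removal-potential : Φ H₁ ≤ Φ H + (2 * ⌊log₂ elems H ⌋ + 4)
    removal-potential = Φ-from-potential H H₁ 0 (λ P P₁ → P₁ ≤ P + (2 * L + 4)) (λ t →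
      ≤-trans (potential-decrement (t + 0)) (+-monoʳ-≤ (potential (size H) (t + 0))
        (≤-trans (nonemptyCount-≤ (size H) (2 * L + 3) (λ k → nonempty-index-≤ k inv) (t + 0))
                 (≤-reflexive (sym (+-suc (2 * L) 3))))))
      where
      open RemoveMinProfile decrement unchanged
      L : ℕ
      L = ⌊log₂ elems H ⌋

    underflow-amortized : t₂ ≤ 1 × Φ H₂ ≤ Φ H₁ + 14 × Relaxed (size H₂)
    underflow-amortized with underflow
    ... | inj₁ (_ , inj₁ uu) = underflowUp-amortized uu j≤11 H₁-below relaxed₁
    ... | inj₁ (_ , inj₂ ut) = ⊥-elim (underflowThru-impossible ut H₁-below)
    ... | inj₂ (_ , H₂≡H₁ , t₂≡0) =
      subst (_≤ 1) (sym t₂≡0) z≤n ,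
      subst (λ X → Φ X ≤ Φ H₁ + 14) (sym H₂≡H₁) (m≤m+n (Φ H₁) 14) ,
      subst (λ X → Relaxed (size X)) (sym H₂≡H₁) relaxed₁

    underflow-cost : t₂ ≤ 1
    underflow-cost = proj₁ underflow-amortized

    underflow-potential : Φ H₂ ≤ Φ H₁ + 14
    underflow-potential = proj₁ (proj₂ underflow-amortized)

    restore-bound : t₃ + scale * Φ H′ ≤ scale * Φ H₂
    restore-bound = restore-amortized restore (proj₂ (proj₂ underflow-amortized))

lemma9 : Σ ℕ λ c → Σ ℕ λ d → (O : StrictTotalOrder 0ℓ 0ℓ 0ℓ) → (H H' : FH.Heap O) → (t : ℕ) → FH.Inv O H → 0 < FH.elems O H → FH.DeleteMinRun O H H' t → t + c * FH.Φ O H' ≤ c * FH.Φ O H + d * (⌊log₂ FH.elems O H ⌋ + 1)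
lemma9 = scale , 18378 , amortized
  where
  amortized : (O : StrictTotalOrder 0ℓ 0ℓ 0ℓ) → (H H′ : FH.Heap O) → (t : ℕ) → FH.Inv O H →
              0 < FH.elems O H → FH.DeleteMinRun O H H′ t →
              t + scale * FH.Φ O H′ ≤ scale * FH.Φ O H + 18378 * (⌊log₂ FH.elems O H ⌋ + 1)
  amortized O H H′ t inv _ run = begin
    t + scale * Φ H′                          ≡⟨ cong (_+ scale * Φ H′) total ⟩
    t₁ + t₂ + t₃ + scale * Φ H′               ≡⟨ +-assoc (t₁ + t₂) t₃ (scale * Φ H′) ⟩
    t₁ + t₂ + (t₃ + scale * Φ H′)             ≤⟨ +-mono-≤ (+-mono-≤ removal-cost underflow-cost) restore-bound ⟩
    378 + scale * Φ H₂                        ≤⟨ +-monoʳ-≤ 378 (*-monoʳ-≤ scale Φ₂-bound) ⟩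
    378 + scale * (Φ H + (2 * L + 4) + 14)    ≡⟨ expand (Φ H) L ⟩
    scale * Φ H + (2000 * L + 18378)          ≤⟨ +-monoʳ-≤ (scale * Φ H) (+-monoˡ-≤ 18378 (*-monoˡ-≤ L 2000≤18378)) ⟩
    scale * Φ H + (18378 * L + 18378)         ≡⟨ cong (scale * Φ H +_) (*-distribˡ-+ 18378 L 1) ⟨
    scale * Φ H + 18378 * (L + 1)             ∎
    where
    open FH O
    open DeleteMinPhases O inv run
    open ≤-Reasoning
    L : ℕ
    L = ⌊log₂ elems H ⌋
    Φ₂-bound : Φ H₂ ≤ Φ H + (2 * L + 4) + 14
    Φ₂-bound = ≤-trans underflow-potential (+-monoˡ-≤ 14 removal-potential)
    2000≤18378 : 2000 ≤ 18378
    2000≤18378 = m≤m+n 2000 16378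
    expand : ∀ P L → 378 + 1000 * (P + (2 * L + 4) + 14) ≡ 1000 * P + (2000 * L + 18378)
    expand = solve-∀
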